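{- Let $(S_k)_{0\le k\le n}$ be the random walk on $\mathbb{N}_0$ with reflecting barrier at $0$ started at $S_0=0$. For all integers $h\ge 0$ and $n\ge 1$, \[ p_n^{(h)} := \mathbb{P}(0\le S_0,S_1,\ldots,S_n\le h \text{ and } S_n=h) = 2\,[z^{n+1}]\,\frac{1}{T_{h+1}(1/z)}. \]
   Context: The random walk on $\mathbb{N}_0$ with reflecting barrier satisfies $\mathbb{P}(S_0=0)=1$, $\mathbb{P}(S_k=j-1\mid S_{k-1}=j)=\mathbb{P}(S_k=j+1\mid S_{k-1}=j)=\tfrac12$ for $j\ge1$, and $\mathbb{P}(S_k=1\mid S_{k-1}=0)=1$. $T_h$ denotes the Chebyshev polynomials of the first kind: $T_0(x)=1$, $T_1(x)=x$, $T_{h+1}(x)=2xT_h(x)-T_{h-1}(x)$ for $h\ge1$. The function $1/T_{h+1}(1/z)$ is expanded as a power series in $z$ around $0$, and $[z^{N}]f(z)$ denotes the coefficient of $z^N$. -}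

module Defs where

open import Data.Nat as ℕ using (ℕ; zero; suc; _∸_; _≤ᵇ_)
open import Data.Bool using (Bool; true; false; if_then_else_)
open import Data.Rational as ℚ using (ℚ; 0ℚ; 1ℚ; ½; _+_; _*_; -_; 1/_; ≢-nonZero)
open import Data.Rational.Properties using (_≟_)
open import Data.List using (List; []; _∷_; map; concatMap; upTo; zipWith; applyUpTo; foldr; last)
open import Data.Maybe using (just; nothing)
open import Relation.Nullary using (yes; no)

_==_ : ℕ → ℕ → Bool
m == n = (m ≤ᵇ n) Data.Bool.∧ (n ≤ᵇ m)

twoℚ : ℚ
twoℚ = 1ℚ + 1ℚ

sumℚ : List ℚ → ℚ
sumℚ = foldr _+_ 0ℚ

-- Reflecting random walk on ℕ₀: one-step transition probabilities
-- trans i j = P(S_k = j | S_{k-1} = i)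

trans : ℕ → ℕ → ℚ
trans zero j = if j == 1 then 1ℚ else 0ℚ
trans (suc i) j = if (j == i) Data.Bool.∨ (j == suc (suc i)) then ½ else 0ℚ

boxSeqs : ℕ → ℕ → List (List ℕ)
boxSeqs h zero = [] ∷ []
boxSeqs h (suc n) = concatMap (λ x → map (x ∷_) (boxSeqs h n)) (upTo (suc h))

pathWeight : ℕ → List ℕ → ℚ
pathWeight prev [] = 1ℚ
pathWeight prev (x ∷ xs) = trans prev x * pathWeight x xs

endsAt : ℕ → List ℕ → Bool
endsAt h s with last s
... | just x = x == h
... | nothing = false

-- p h n = P(0 ≤ S_0,…,S_n ≤ h and S_n = h), with S_0 = 0 a.s.
-- (sum over all trajectories in the event of their Markov-chain probability)
prob : ℕ → ℕ → ℚ
prob h n = sumℚ (map (λ s → if endsAt h (0 ∷ s) then pathWeight 0 s else 0ℚ) (boxSeqs h n))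

-- Chebyshev polynomials of the first kind, as coefficient functions:
-- cheb h i = coefficient of x^i in T_h(x)

shift : (ℕ → ℚ) → ℕ → ℚ
shift f zero = 0ℚ
shift f (suc i) = f i

cheb : ℕ → ℕ → ℚ
cheb zero i = if i == 0 then 1ℚ else 0ℚ
cheb (suc zero) i = if i == 1 then 1ℚ else 0ℚ
cheb (suc (suc h)) i = twoℚ * shift (cheb (suc h)) i ℚ.- cheb h i

-- inverse of a rational, with the harmless convention inv 0 = 0
-- (only ever applied below to a nonzero constant term)
inv : ℚ → ℚ
inv q with q ≟ 0ℚ
... | yes _ = 0ℚ
... | no q≢0 = 1/_ q {{≢-nonZero q≢0}}

-- recipRev Q m = [b_m, b_{m-1}, …, b_0] where Σ b_k z^k = 1 / Σ Q_j z^j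
-- (b_0 = 1/Q_0, b_m = -(Σ_{j=1}^m Q_j b_{m-j}) / Q_0)
recipRev : (ℕ → ℚ) → ℕ → List ℚ
recipRev Q zero = inv (Q 0) ∷ []
recipRev Q (suc m) =
  let bs = recipRev Q m in
  (- (sumℚ (zipWith _*_ (applyUpTo (λ j → Q (suc j)) (suc m)) bs)) * inv (Q 0)) ∷ bs

recip : (ℕ → ℚ) → ℕ → ℚ
recip Q m with recipRev Q m
... | b ∷ _ = b
... | [] = 0ℚ

-- With d = h+1 and T_d(x) = Σ_{i≤d} c_i x^i, we have
-- T_d(1/z) = z^{-d} Q(z), Q(z) = Σ_{j≤d} c_{d-j} z^j, Q(0) = c_d = 2^h ≠ 0,
-- so 1/T_d(1/z) = z^d · (1/Q(z)) is a genuine power series in z and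
-- [z^N] of it is [z^{N-d}] (1/Q) for N ≥ d and 0 otherwise.
revCheb : ℕ → ℕ → ℚ
revCheb d j = if j ≤ᵇ d then cheb d (d ∸ j) else 0ℚ

coeffInvChebRec : ℕ → ℕ → ℚ
coeffInvChebRec h N = if suc h ≤ᵇ N then recip (revCheb (suc h)) (N ∸ suc h) else 0ℚ

-- Let r(n, p) = reach n p be the probability that the walk started at p stays in [0, h]
-- for n steps and ends at h.  Conditioning on the first step,
-- r(n+1, k+1) = ½ r(n, k) + ½ r(n, k+2) inside the strip, and r(n+1, 0) = r(n, 1).
-- With E the shift n ↦ n+1, this is the Chebyshev recursion
-- 2E·r(·, k+1) = r(·, k) + r(·, k+2), so r(·, k) = T_k(E) r(·, 0) for k ≤ h+1,
-- and r(·, h+1) = 0 says that T_{h+1}(E) annihilates the sequence p_n = r(n, 0).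
-- The coefficients of 1/T_{h+1}(1/z) = z^{h+1}/Q(z), with Q the reversal of
-- T_{h+1}, satisfy the same linear recurrence because Q · (1/Q) = 1.  The
-- leading coefficient of T_{h+1} is 2^h, so both sequences are determined by
-- their first h+1 terms, which for h ≥ 1 are 0, …, 0, 2^{1-h} on both sides.

module Submission where

open import Defs
open import Data.Bool using (Bool; true; false; if_then_else_)
open import Data.List using (List; []; _∷_; _++_; map; concatMap; applyUpTo; upTo; zipWith)
open import Data.List.Properties using (map-++; map-∘; map-cong)
open import Data.Nat as ℕ using (ℕ; zero; suc; _≤_; _<_; z≤n; s≤s; _∸_; _≤ᵇ_)
import Data.Nat.Properties as ℕₚ
open import Data.Rational using (ℚ; 0ℚ; 1ℚ; ½; _+_; _*_; -_; _-_; 1/_; ≢-nonZero)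
import Data.Rational.Properties as ℚₚ
open import Data.Rational.Solver using (module +-*-Solver)
open import Data.Sum using (inj₁; inj₂)
open import Relation.Binary.PropositionalEquality renaming (trans to ≡-trans)
open import Relation.Binary.Definitions using (tri<; tri≈; tri>)
open import Relation.Nullary using (¬_; yes; no; contradiction)
open +-*-Solver

≤ᵇ-true : ∀ {m n} → m ≤ n → (m ≤ᵇ n) ≡ true
≤ᵇ-true {m} {n} m≤n with m ≤ᵇ n | ℕₚ.≤⇒≤ᵇ m≤n
... | true | _ = refl

≤ᵇ-false : ∀ {m n} → n < m → (m ≤ᵇ n) ≡ false
≤ᵇ-false {m} {n} n<m with m ≤ᵇ n | ℕₚ.≤ᵇ⇒≤ m n
... | false | _ = refl
... | true | m≤n = contradiction (m≤n _) (ℕₚ.<⇒≱ n<m)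

==-refl : ∀ n → (n == n) ≡ true
==-refl n rewrite ≤ᵇ-true (ℕₚ.≤-refl {n}) = refl

==-≢ : ∀ {m n} → ¬ m ≡ n → (m == n) ≡ false
==-≢ {m} {n} m≢n with ℕₚ.<-cmp m n
... | tri< m<n _ _ rewrite ≤ᵇ-false m<n | ≤ᵇ-true (ℕₚ.<⇒≤ m<n) = refl
... | tri≈ _ m≡n _ = contradiction m≡n m≢n
... | tri> _ _ n<m rewrite ≤ᵇ-false n<m = refl

sumTo : ℕ → (ℕ → ℚ) → ℚ
sumTo zero f = 0ℚ
sumTo (suc n) f = f 0 + sumTo n (λ i → f (suc i))

sumTo-cong : ∀ n {f g : ℕ → ℚ} → (∀ i → i < n → f i ≡ g i) → sumTo n f ≡ sumTo n g
sumTo-cong zero f≡g = refl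
sumTo-cong (suc n) f≡g =
  cong₂ _+_ (f≡g 0 (s≤s z≤n)) (sumTo-cong n (λ i i<n → f≡g (suc i) (s≤s i<n)))

sumTo-zero : ∀ n (f : ℕ → ℚ) → (∀ i → i < n → f i ≡ 0ℚ) → sumTo n f ≡ 0ℚ
sumTo-zero zero f f≡0 = refl
sumTo-zero (suc n) f f≡0 =
  cong₂ _+_ (f≡0 0 (s≤s z≤n)) (sumTo-zero n _ (λ i i<n → f≡0 (suc i) (s≤s i<n)))

sumTo-+ : ∀ n (f g : ℕ → ℚ) → sumTo n (λ i → f i + g i) ≡ sumTo n f + sumTo n g
sumTo-+ zero f g = refl
sumTo-+ (suc n) f g rewrite sumTo-+ n (λ i → f (suc i)) (λ i → g (suc i)) =
  solve 4 (λ a b c d → (a :+ b) :+ (c :+ d) := (a :+ c) :+ (b :+ d)) refl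
    (f 0) (g 0) (sumTo n (λ i → f (suc i))) (sumTo n (λ i → g (suc i)))

sumTo-sub : ∀ n (f g : ℕ → ℚ) → sumTo n (λ i → f i - g i) ≡ sumTo n f - sumTo n g
sumTo-sub zero f g = refl
sumTo-sub (suc n) f g rewrite sumTo-sub n (λ i → f (suc i)) (λ i → g (suc i)) =
  solve 4 (λ a b c d → (a :- b) :+ (c :- d) := (a :+ c) :- (b :+ d)) refl
    (f 0) (g 0) (sumTo n (λ i → f (suc i))) (sumTo n (λ i → g (suc i)))

sumTo-scale : ∀ n c (f : ℕ → ℚ) → sumTo n (λ i → c * f i) ≡ c * sumTo n f
sumTo-scale zero c f = sym (ℚₚ.*-zeroʳ c)
sumTo-scale (suc n) c f rewrite sumTo-scale n c (λ i → f (suc i)) =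
  sym (ℚₚ.*-distribˡ-+ c (f 0) _)

sumTo-last : ∀ n (f : ℕ → ℚ) → sumTo (suc n) f ≡ sumTo n f + f n
sumTo-last zero f = ≡-trans (ℚₚ.+-identityʳ (f 0)) (sym (ℚₚ.+-identityˡ (f 0)))
sumTo-last (suc n) f rewrite sumTo-last n (λ i → f (suc i)) = sym (ℚₚ.+-assoc (f 0) _ _)

sumTo-extend : ∀ a k (f : ℕ → ℚ) → (∀ i → a ≤ i → f i ≡ 0ℚ) → sumTo (a ℕ.+ k) f ≡ sumTo a f
sumTo-extend a zero f f≡0 rewrite ℕₚ.+-identityʳ a = refl
sumTo-extend a (suc k) f f≡0
  rewrite ℕₚ.+-suc a k | sumTo-last (a ℕ.+ k) f | f≡0 (a ℕ.+ k) (ℕₚ.m≤m+n a k) =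
  ≡-trans (ℚₚ.+-identityʳ _) (sumTo-extend a k f f≡0)

sumTo-support : ∀ a b (f : ℕ → ℚ) →
  (∀ i → a ≤ i → f i ≡ 0ℚ) → (∀ i → b ≤ i → f i ≡ 0ℚ) → sumTo a f ≡ sumTo b f
sumTo-support a b f f≡0₁ f≡0₂ = begin
  sumTo a f           ≡⟨ sym (sumTo-extend a b f f≡0₁) ⟩
  sumTo (a ℕ.+ b) f   ≡⟨ cong (λ n → sumTo n f) (ℕₚ.+-comm a b) ⟩
  sumTo (b ℕ.+ a) f   ≡⟨ sumTo-extend b a f f≡0₂ ⟩
  sumTo b f           ∎
  where open ≡-Reasoning

sumTo-reverse : ∀ n (f : ℕ → ℚ) → sumTo (suc n) f ≡ sumTo (suc n) (λ j → f (n ∸ j))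
sumTo-reverse zero f = refl
sumTo-reverse (suc n) f = begin
  sumTo (suc (suc n)) f                         ≡⟨ sumTo-last (suc n) f ⟩
  sumTo (suc n) f + f (suc n)                   ≡⟨ cong (_+ f (suc n)) (sumTo-reverse n f) ⟩
  sumTo (suc n) (λ j → f (n ∸ j)) + f (suc n)   ≡⟨ ℚₚ.+-comm _ (f (suc n)) ⟩
  f (suc n) + sumTo (suc n) (λ j → f (n ∸ j))   ∎
  where open ≡-Reasoning

sumℚ-applyUpTo : ∀ n (f : ℕ → ℚ) (g : ℕ → ℕ) →
  sumℚ (map f (applyUpTo g n)) ≡ sumTo n (λ i → f (g i))
sumℚ-applyUpTo zero f g = refl
sumℚ-applyUpTo (suc n) f g = cong (f (g 0) +_) (sumℚ-applyUpTo n f (λ i → g (suc i)))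

sumℚ-++ : ∀ xs ys → sumℚ (xs ++ ys) ≡ sumℚ xs + sumℚ ys
sumℚ-++ [] ys = sym (ℚₚ.+-identityˡ _)
sumℚ-++ (x ∷ xs) ys rewrite sumℚ-++ xs ys = sym (ℚₚ.+-assoc x (sumℚ xs) (sumℚ ys))

sumℚ-map-concatMap : ∀ {A B : Set} (F : B → ℚ) (G : A → List B) xs →
  sumℚ (map F (concatMap G xs)) ≡ sumℚ (map (λ x → sumℚ (map F (G x))) xs)
sumℚ-map-concatMap F G [] = refl
sumℚ-map-concatMap F G (x ∷ xs) = begin
  sumℚ (map F (G x ++ concatMap G xs))             ≡⟨ cong sumℚ (map-++ F (G x) (concatMap G xs)) ⟩
  sumℚ (map F (G x) ++ map F (concatMap G xs))     ≡⟨ sumℚ-++ (map F (G x)) _ ⟩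
  sumℚ (map F (G x)) + sumℚ (map F (concatMap G xs))
    ≡⟨ cong (sumℚ (map F (G x)) +_) (sumℚ-map-concatMap F G xs) ⟩
  sumℚ (map F (G x)) + sumℚ (map (λ y → sumℚ (map F (G y))) xs) ∎
  where open ≡-Reasoning

sumℚ-scale : ∀ {A : Set} c (F : A → ℚ) xs → sumℚ (map (λ x → c * F x) xs) ≡ c * sumℚ (map F xs)
sumℚ-scale c F [] = sym (ℚₚ.*-zeroʳ c)
sumℚ-scale c F (x ∷ xs) rewrite sumℚ-scale c F xs = sym (ℚₚ.*-distribˡ-+ c (F x) _)

if-scale : ∀ (b : Bool) t a → (if b then t * a else 0ℚ) ≡ t * (if b then a else 0ℚ)
if-scale true t a = refl
if-scale false t a = sym (ℚₚ.*-zeroʳ t)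

indicator : ℕ → ℚ → ℕ → ℚ
indicator a c x = if x == a then c else 0ℚ

sumTo-indicator-out : ∀ m a c (v : ℕ → ℚ) → m ≤ a → sumTo m (λ x → indicator a c x * v x) ≡ 0ℚ
sumTo-indicator-out m a c v m≤a = sumTo-zero m _ λ x x<m →
  ≡-trans (cong (λ b → (if b then c else 0ℚ) * v x) (==-≢ {x} {a} λ { refl → ℕₚ.<⇒≱ x<m m≤a }))
          (ℚₚ.*-zeroˡ (v x))

sumTo-indicator-in : ∀ m a c (v : ℕ → ℚ) → a < m → sumTo m (λ x → indicator a c x * v x) ≡ c * v a
sumTo-indicator-in (suc m) a c v a<1+m with ℕₚ.m≤n⇒m<n∨m≡n (ℕₚ.≤-pred a<1+m)
... | inj₁ a<m = begin
  sumTo (suc m) (λ x → indicator a c x * v x)        ≡⟨ sumTo-last m _ ⟩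
  sumTo m (λ x → indicator a c x * v x) + indicator a c m * v m
    ≡⟨ cong₂ _+_ (sumTo-indicator-in m a c v a<m)
                 (cong (λ b → (if b then c else 0ℚ) * v m) (==-≢ (ℕₚ.>⇒≢ a<m))) ⟩
  c * v a + 0ℚ * v m                                 ≡⟨ cong (c * v a +_) (ℚₚ.*-zeroˡ (v m)) ⟩
  c * v a + 0ℚ                                       ≡⟨ ℚₚ.+-identityʳ _ ⟩
  c * v a                                            ∎
  where open ≡-Reasoning
... | inj₂ refl = begin
  sumTo (suc a) (λ x → indicator a c x * v x)        ≡⟨ sumTo-last a _ ⟩
  sumTo a (λ x → indicator a c x * v x) + indicator a c a * v a
    ≡⟨ cong₂ _+_ (sumTo-indicator-out a a c v ℕₚ.≤-refl)
                 (cong (λ b → (if b then c else 0ℚ) * v a) (==-refl a)) ⟩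
  0ℚ + c * v a                                       ≡⟨ ℚₚ.+-identityˡ _ ⟩
  c * v a                                            ∎
  where open ≡-Reasoning

sumTo-indicator : ∀ h a c (v : ℕ → ℚ) → (∀ x → h < x → v x ≡ 0ℚ) →
  sumTo (suc h) (λ x → indicator a c x * v x) ≡ c * v a
sumTo-indicator h a c v v≡0 with a ℕ.≤? h
... | yes a≤h = sumTo-indicator-in (suc h) a c v (s≤s a≤h)
... | no a≰h = begin
  sumTo (suc h) (λ x → indicator a c x * v x)   ≡⟨ sumTo-indicator-out (suc h) a c v (ℕₚ.≰⇒> a≰h) ⟩
  0ℚ                                            ≡⟨ sym (ℚₚ.*-zeroʳ c) ⟩
  c * 0ℚ                                        ≡⟨ cong (c *_) (sym (v≡0 a (ℕₚ.≰⇒> a≰h))) ⟩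
  c * v a                                       ∎
  where open ≡-Reasoning

trans-suc : ∀ q x → trans (suc q) x ≡ indicator q ½ x + indicator (suc (suc q)) ½ x
trans-suc q x with x ℕ.≟ q
... | yes refl rewrite ==-refl x | ==-≢ {x} {suc (suc x)} (λ ()) = refl
... | no x≢q rewrite ==-≢ x≢q = sym (ℚₚ.+-identityˡ _)

sumTo-trans-zero : ∀ h (v : ℕ → ℚ) → (∀ x → h < x → v x ≡ 0ℚ) →
  sumTo (suc h) (λ x → trans 0 x * v x) ≡ v 1
sumTo-trans-zero h v v≡0 = ≡-trans (sumTo-indicator h 1 1ℚ v v≡0) (ℚₚ.*-identityˡ (v 1))

sumTo-trans-suc : ∀ h q (v : ℕ → ℚ) → (∀ x → h < x → v x ≡ 0ℚ) →
  sumTo (suc h) (λ x → trans (suc q) x * v x) ≡ ½ * v q + ½ * v (suc (suc q))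
sumTo-trans-suc h q v v≡0 = begin
  sumTo (suc h) (λ x → trans (suc q) x * v x)
    ≡⟨ sumTo-cong (suc h) (λ x _ → split x) ⟩
  sumTo (suc h) (λ x → indicator q ½ x * v x + indicator (suc (suc q)) ½ x * v x)
    ≡⟨ sumTo-+ (suc h) (λ x → indicator q ½ x * v x) (λ x → indicator (suc (suc q)) ½ x * v x) ⟩
  sumTo (suc h) (λ x → indicator q ½ x * v x) + sumTo (suc h) (λ x → indicator (suc (suc q)) ½ x * v x)
    ≡⟨ cong₂ _+_ (sumTo-indicator h q ½ v v≡0) (sumTo-indicator h (suc (suc q)) ½ v v≡0) ⟩
  ½ * v q + ½ * v (suc (suc q)) ∎
  where
    open ≡-Reasoning
    split : ∀ x → trans (suc q) x * v x ≡ indicator q ½ x * v x + indicator (suc (suc q)) ½ x * v x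
    split x = ≡-trans (cong (_* v x) (trans-suc q x))
                      (ℚₚ.*-distribʳ-+ (v x) (indicator q ½ x) (indicator (suc (suc q)) ½ x))

shiftPoly : ℕ → (ℕ → ℚ) → (ℕ → ℚ) → ℕ → ℚ
shiftPoly d c x m = sumTo (suc d) (λ i → c i * x (i ℕ.+ m))

Annihilates : ℕ → (ℕ → ℚ) → (ℕ → ℚ) → Set
Annihilates d c x = ∀ m → shiftPoly d c x m ≡ 0ℚ

Annihilates-scale : ∀ d c x a → Annihilates d c x → Annihilates d c (λ n → a * x n)
Annihilates-scale d c x a cx≡0 m = begin
  sumTo (suc d) (λ i → c i * (a * x (i ℕ.+ m)))
    ≡⟨ sumTo-cong (suc d) (λ i _ → swap (c i) a (x (i ℕ.+ m))) ⟩
  sumTo (suc d) (λ i → a * (c i * x (i ℕ.+ m)))   ≡⟨ sumTo-scale (suc d) a (λ i → c i * x (i ℕ.+ m)) ⟩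
  a * shiftPoly d c x m                          ≡⟨ cong (a *_) (cx≡0 m) ⟩
  a * 0ℚ                                         ≡⟨ ℚₚ.*-zeroʳ a ⟩
  0ℚ                                             ∎
  where
    open ≡-Reasoning
    swap : ∀ p q r → p * (q * r) ≡ q * (p * r)
    swap = solve 3 (λ p q r → p :* (q :* r) := q :* (p :* r)) refl

solve-linear : ∀ {a a⁻¹ s u} → a * a⁻¹ ≡ 1ℚ → s + a * u ≡ 0ℚ → u ≡ - s * a⁻¹
solve-linear {a} {a⁻¹} {s} {u} aa⁻¹≡1 s+au≡0 = begin
  u                          ≡⟨ sym (ℚₚ.*-identityˡ u) ⟩
  1ℚ * u                     ≡⟨ cong (_* u) (sym aa⁻¹≡1) ⟩
  a * a⁻¹ * u                ≡⟨ solve 4 (λ s u a b → a :* b :* u := ((s :+ a :* u) :- s) :* b) refl s u a a⁻¹ ⟩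
  ((s + a * u) - s) * a⁻¹    ≡⟨ cong (λ t → (t - s) * a⁻¹) s+au≡0 ⟩
  (0ℚ - s) * a⁻¹             ≡⟨ cong (_* a⁻¹) (ℚₚ.+-identityˡ (- s)) ⟩
  - s * a⁻¹                  ∎
  where open ≡-Reasoning

Annihilates-next : ∀ d c x a⁻¹ → c (suc d) * a⁻¹ ≡ 1ℚ → Annihilates (suc d) c x →
  ∀ m → x (suc d ℕ.+ m) ≡ - shiftPoly d c x m * a⁻¹
Annihilates-next d c x a⁻¹ ca⁻¹≡1 cx≡0 m = solve-linear {c (suc d)} {s = shiftPoly d c x m} ca⁻¹≡1
  (≡-trans (sym (sumTo-last (suc d) (λ i → c i * x (i ℕ.+ m)))) (cx≡0 m))

Annihilates-unique : ∀ d c x y a⁻¹ → c (suc d) * a⁻¹ ≡ 1ℚ →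
  Annihilates (suc d) c x → Annihilates (suc d) c y → (∀ i → i ≤ d → x i ≡ y i) → ∀ m → x m ≡ y m
Annihilates-unique d c x y a⁻¹ ca⁻¹≡1 cx≡0 cy≡0 x≡y m = window m 0 z≤n
  where
    window : ∀ m i → i ≤ d → x (i ℕ.+ m) ≡ y (i ℕ.+ m)
    window zero i i≤d rewrite ℕₚ.+-identityʳ i = x≡y i i≤d
    window (suc m) i i≤d with ℕₚ.m≤n⇒m<n∨m≡n i≤d
    ... | inj₁ i<d rewrite ℕₚ.+-suc i m = window m (suc i) i<d
    ... | inj₂ refl rewrite ℕₚ.+-suc i m = begin
      x (suc i ℕ.+ m)               ≡⟨ Annihilates-next i c x a⁻¹ ca⁻¹≡1 cx≡0 m ⟩
      - shiftPoly i c x m * a⁻¹      ≡⟨ cong (λ s → - s * a⁻¹) (sumTo-cong (suc i) λ j j≤i →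
                                         cong (c j *_) (window m j (ℕₚ.≤-pred j≤i))) ⟩
      - shiftPoly i c y m * a⁻¹      ≡⟨ sym (Annihilates-next i c y a⁻¹ ca⁻¹≡1 cy≡0 m) ⟩
      y (suc i ℕ.+ m)               ∎
      where open ≡-Reasoning

Annihilates-X⇒vanish : ∀ (x : ℕ → ℚ) → Annihilates 1 (cheb 1) x → ∀ m → x (suc m) ≡ 0ℚ
Annihilates-X⇒vanish x cx≡0 m =
  ≡-trans (solve 2 (λ a b → b := con 0ℚ :* a :+ (con 1ℚ :* b :+ con 0ℚ)) refl (x m) (x (suc m))) (cx≡0 m)

cheb-degree : ∀ k i → k < i → cheb k i ≡ 0ℚ
cheb-degree zero (suc i) _ = refl
cheb-degree (suc zero) (suc zero) (s≤s ())
cheb-degree (suc zero) (suc (suc i)) _ = refl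
cheb-degree (suc (suc k)) (suc i) (s≤s k+1<i)
  rewrite cheb-degree (suc k) i k+1<i
        | cheb-degree k (suc i) (ℕₚ.<-trans (ℕₚ.n<1+n k) (ℕₚ.m<n⇒m<1+n k+1<i)) = refl

½^_ : ℕ → ℚ
½^ zero = 1ℚ
½^ suc k = ½ * ½^ k

cheb-leading : ∀ k → cheb (suc k) (suc k) * ½^ k ≡ 1ℚ
cheb-leading zero = refl
cheb-leading (suc k) rewrite cheb-degree k (suc (suc k)) (ℕₚ.m<n⇒m<1+n (ℕₚ.n<1+n k)) =
  ≡-trans (solve 2 (λ c p → (con twoℚ :* c :- con 0ℚ) :* (con ½ :* p) := c :* p) refl
                   (cheb (suc k) (suc k)) (½^ k))
          (cheb-leading k)

shiftPoly-cheb : ∀ k x n → shiftPoly (suc (suc k)) (cheb (suc (suc k))) x n ≡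
  twoℚ * shiftPoly (suc k) (cheb (suc k)) x (suc n) - shiftPoly k (cheb k) x n
shiftPoly-cheb k x n = begin
  sumTo (3 ℕ.+ k) (λ i → (twoℚ * shift c₁ i - c₀ i) * x (i ℕ.+ n))
    ≡⟨ sumTo-cong (3 ℕ.+ k) (λ i _ → distrib (shift c₁ i) (c₀ i) (x (i ℕ.+ n))) ⟩
  sumTo (3 ℕ.+ k) (λ i → twoℚ * (shift c₁ i * x (i ℕ.+ n)) - c₀ i * x (i ℕ.+ n))
    ≡⟨ sumTo-sub (3 ℕ.+ k) (λ i → twoℚ * (shift c₁ i * x (i ℕ.+ n))) (λ i → c₀ i * x (i ℕ.+ n)) ⟩
  sumTo (3 ℕ.+ k) (λ i → twoℚ * (shift c₁ i * x (i ℕ.+ n))) - sumTo (3 ℕ.+ k) (λ i → c₀ i * x (i ℕ.+ n))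
    ≡⟨ cong₂ _-_ (sumTo-scale (3 ℕ.+ k) twoℚ (λ i → shift c₁ i * x (i ℕ.+ n))) T₀-padded ⟩
  twoℚ * sumTo (3 ℕ.+ k) (λ i → shift c₁ i * x (i ℕ.+ n)) - shiftPoly k c₀ x n
    ≡⟨ cong (λ s → twoℚ * s - shiftPoly k c₀ x n) T₁-shifted ⟩
  twoℚ * shiftPoly (suc k) c₁ x (suc n) - shiftPoly k c₀ x n ∎
  where
    open ≡-Reasoning
    c₀ = cheb k
    c₁ = cheb (suc k)
    distrib : ∀ s c y → (twoℚ * s - c) * y ≡ twoℚ * (s * y) - c * y
    distrib = solve 3 (λ s c y → (con twoℚ :* s :- c) :* y := con twoℚ :* (s :* y) :- c :* y) refl
    T₁-shifted : sumTo (3 ℕ.+ k) (λ i → shift c₁ i * x (i ℕ.+ n)) ≡ shiftPoly (suc k) c₁ x (suc n)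
    T₁-shifted = begin
      0ℚ * x n + sumTo (2 ℕ.+ k) (λ i → c₁ i * x (suc i ℕ.+ n))
        ≡⟨ cong (_+ sumTo (2 ℕ.+ k) (λ i → c₁ i * x (suc i ℕ.+ n))) (ℚₚ.*-zeroˡ (x n)) ⟩
      0ℚ + sumTo (2 ℕ.+ k) (λ i → c₁ i * x (suc i ℕ.+ n))
        ≡⟨ ℚₚ.+-identityˡ _ ⟩
      sumTo (2 ℕ.+ k) (λ i → c₁ i * x (suc i ℕ.+ n))
        ≡⟨ sumTo-cong (2 ℕ.+ k) (λ i _ → cong (λ j → c₁ i * x j) (sym (ℕₚ.+-suc i n))) ⟩
      shiftPoly (suc k) c₁ x (suc n) ∎
    T₀-padded : sumTo (3 ℕ.+ k) (λ i → c₀ i * x (i ℕ.+ n)) ≡ shiftPoly k c₀ x n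
    T₀-padded = ≡-trans (cong (λ j → sumTo j (λ i → c₀ i * x (i ℕ.+ n))) (ℕₚ.+-comm 2 (suc k)))
                        (sumTo-extend (suc k) 2 (λ i → c₀ i * x (i ℕ.+ n)) beyond-degree)
      where
        beyond-degree : ∀ i → suc k ≤ i → c₀ i * x (i ℕ.+ n) ≡ 0ℚ
        beyond-degree i k<i = ≡-trans (cong (_* x (i ℕ.+ n)) (cheb-degree k i k<i)) (ℚₚ.*-zeroˡ (x (i ℕ.+ n)))

module Walk (h : ℕ) where

  reach : ℕ → ℕ → ℚ
  reach zero p = if p == h then 1ℚ else 0ℚ
  reach (suc n) zero = reach n 1
  reach (suc n) (suc q) = if suc q ≤ᵇ h then ½ * reach n q + ½ * reach n (suc (suc q)) else 0ℚ

  reach-out : ∀ n p → h < p → reach n p ≡ 0ℚ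
  reach-out zero p h<p rewrite ==-≢ (ℕₚ.>⇒≢ h<p) = refl
  reach-out (suc n) (suc q) h<p rewrite ≤ᵇ-false h<p = refl

  reach-step : ∀ n q → suc q ≤ h → reach (suc n) (suc q) ≡ ½ * reach n q + ½ * reach n (suc (suc q))
  reach-step n q q<h rewrite ≤ᵇ-true q<h = refl

  reach-first-step : ∀ n p → p ≤ h → sumTo (suc h) (λ x → trans p x * reach n x) ≡ reach (suc n) p
  reach-first-step n zero _ = sumTo-trans-zero h (reach n) (reach-out n)
  reach-first-step n (suc q) q<h =
    ≡-trans (sumTo-trans-suc h q (reach n) (reach-out n)) (sym (reach-step n q q<h))

  pathSum : ℕ → ℕ → ℚ
  pathSum n p = sumℚ (map (λ s → if endsAt h (p ∷ s) then pathWeight p s else 0ℚ) (boxSeqs h n))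

  pathSum-suc : ∀ n p → pathSum (suc n) p ≡ sumTo (suc h) (λ x → trans p x * pathSum n x)
  pathSum-suc n p = begin
    sumℚ (map F (concatMap (λ x → map (x ∷_) (boxSeqs h n)) (upTo (suc h))))
      ≡⟨ sumℚ-map-concatMap F (λ x → map (x ∷_) (boxSeqs h n)) (upTo (suc h)) ⟩
    sumℚ (map (λ x → sumℚ (map F (map (x ∷_) (boxSeqs h n)))) (upTo (suc h)))
      ≡⟨ sumℚ-applyUpTo (suc h) (λ x → sumℚ (map F (map (x ∷_) (boxSeqs h n)))) (λ i → i) ⟩
    sumTo (suc h) (λ x → sumℚ (map F (map (x ∷_) (boxSeqs h n))))
      ≡⟨ sumTo-cong (suc h) (λ x _ → first-step x) ⟩
    sumTo (suc h) (λ x → trans p x * pathSum n x) ∎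
    where
      open ≡-Reasoning
      F : List ℕ → ℚ
      F s = if endsAt h (p ∷ s) then pathWeight p s else 0ℚ
      first-step : ∀ x → sumℚ (map F (map (x ∷_) (boxSeqs h n))) ≡ trans p x * pathSum n x
      first-step x = begin
        sumℚ (map F (map (x ∷_) (boxSeqs h n)))     ≡⟨ cong sumℚ (sym (map-∘ (boxSeqs h n))) ⟩
        sumℚ (map (λ s → F (x ∷ s)) (boxSeqs h n))
          ≡⟨ cong sumℚ (map-cong (λ s → if-scale (endsAt h (x ∷ s)) (trans p x) (pathWeight x s)) (boxSeqs h n)) ⟩
        sumℚ (map (λ s → trans p x * (if endsAt h (x ∷ s) then pathWeight x s else 0ℚ)) (boxSeqs h n))
          ≡⟨ sumℚ-scale (trans p x) _ (boxSeqs h n) ⟩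
        trans p x * pathSum n x ∎

  pathSum≡reach : ∀ n p → p ≤ h → pathSum n p ≡ reach n p
  pathSum≡reach zero p _ = ℚₚ.+-identityʳ _
  pathSum≡reach (suc n) p p≤h = begin
    pathSum (suc n) p                                ≡⟨ pathSum-suc n p ⟩
    sumTo (suc h) (λ x → trans p x * pathSum n x)
      ≡⟨ sumTo-cong (suc h) (λ x x≤h → cong (trans p x *_) (pathSum≡reach n x (ℕₚ.≤-pred x≤h))) ⟩
    sumTo (suc h) (λ x → trans p x * reach n x)      ≡⟨ reach-first-step n p p≤h ⟩
    reach (suc n) p                                  ∎
    where open ≡-Reasoning

  reach-cheb : ∀ k → k ≤ suc h → ∀ n → shiftPoly k (cheb k) (λ m → reach m 0) n ≡ reach n k
  reach-cheb zero _ n = ≡-trans (ℚₚ.+-identityʳ _) (ℚₚ.*-identityˡ _)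
  reach-cheb (suc zero) _ n =
    solve 2 (λ a b → con 0ℚ :* a :+ (con 1ℚ :* b :+ con 0ℚ) := b) refl (reach n 0) (reach n 1)
  reach-cheb (suc (suc k)) k+2≤h+1 n = begin
    shiftPoly (suc (suc k)) (cheb (suc (suc k))) x n
      ≡⟨ shiftPoly-cheb k x n ⟩
    twoℚ * shiftPoly (suc k) (cheb (suc k)) x (suc n) - shiftPoly k (cheb k) x n
      ≡⟨ cong₂ (λ a b → twoℚ * a - b) (reach-cheb (suc k) (ℕₚ.m≤n⇒m≤1+n k+1≤h) (suc n))
                                      (reach-cheb k (ℕₚ.m≤n⇒m≤1+n (ℕₚ.<⇒≤ k+1≤h)) n) ⟩
    twoℚ * reach (suc n) (suc k) - reach n k
      ≡⟨ cong (λ r → twoℚ * r - reach n k) (reach-step n k k+1≤h) ⟩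
    twoℚ * (½ * reach n k + ½ * reach n (suc (suc k))) - reach n k
      ≡⟨ solve 2 (λ a b → con twoℚ :* (con ½ :* a :+ con ½ :* b) :- a := b) refl (reach n k) (reach n (suc (suc k))) ⟩
    reach n (suc (suc k)) ∎
    where
      open ≡-Reasoning
      x = λ m → reach m 0
      k+1≤h = ℕₚ.≤-pred k+2≤h+1

  reach-annihilated : Annihilates (suc h) (cheb (suc h)) (λ m → reach m 0)
  reach-annihilated m = ≡-trans (reach-cheb (suc h) ℕₚ.≤-refl m) (reach-out m (suc h) ℕₚ.≤-refl)

  reach-below : ∀ n p → p ℕ.+ n < h → reach n p ≡ 0ℚ
  reach-below zero p p+0<h rewrite ℕₚ.+-identityʳ p | ==-≢ (ℕₚ.<⇒≢ p+0<h) = refl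
  reach-below (suc n) zero n+1<h = reach-below n 1 n+1<h
  reach-below (suc n) (suc q) q+n+2<h
    rewrite reach-step n q (ℕₚ.<⇒≤ (ℕₚ.≤-<-trans (ℕₚ.m≤m+n (suc q) (suc n)) q+n+2<h))
          | reach-below n q (ℕₚ.≤-<-trans (ℕₚ.+-monoʳ-≤ q (ℕₚ.n≤1+n n)) (ℕₚ.<-trans (ℕₚ.n<1+n _) q+n+2<h))
          | reach-below n (suc (suc q)) (subst (_< h) (cong suc (ℕₚ.+-suc q n)) q+n+2<h) =
    solve 0 (con ½ :* con 0ℚ :+ con ½ :* con 0ℚ := con 0ℚ) refl

  reach-exact : ∀ n p → suc p ℕ.+ n ≡ h → reach n (suc p) ≡ ½^ n
  reach-exact zero p p+1≡h rewrite sym p+1≡h | ℕₚ.+-identityʳ p | ==-refl (suc p) = refl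
  reach-exact (suc n) p p+n+2≡h
    rewrite reach-step n p (subst (suc p ≤_) p+n+2≡h (ℕₚ.m≤m+n (suc p) (suc n)))
          | reach-below n p (subst (_ <_) p+n+2≡h (s≤s (ℕₚ.+-monoʳ-≤ p (ℕₚ.n≤1+n n))))
          | reach-exact n (suc p) (≡-trans (cong suc (sym (ℕₚ.+-suc p n))) p+n+2≡h) =
    solve 1 (λ a → con ½ :* con 0ℚ :+ con ½ :* a := con ½ :* a) refl (½^ n)

inv-unique : ∀ a b → a * b ≡ 1ℚ → inv a ≡ b
inv-unique a b ab≡1 with a ℚₚ.≟ 0ℚ
... | yes refl = contradiction (≡-trans (sym (ℚₚ.*-zeroˡ b)) ab≡1) λ ()
... | no a≢0 = begin
  1/ a                 ≡⟨ sym (ℚₚ.*-identityʳ _) ⟩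
  1/ a * 1ℚ            ≡⟨ cong (1/ a *_) (sym ab≡1) ⟩
  1/ a * (a * b)       ≡⟨ sym (ℚₚ.*-assoc (1/ a) a b) ⟩
  1/ a * a * b         ≡⟨ cong (_* b) (ℚₚ.*-inverseˡ a) ⟩
  1ℚ * b               ≡⟨ ℚₚ.*-identityˡ b ⟩
  b                    ∎
  where
    open ≡-Reasoning
    instance _ = ≢-nonZero a≢0

*-inv : ∀ a b → a * b ≡ 1ℚ → a * inv a ≡ 1ℚ
*-inv a b ab≡1 = subst (λ c → a * c ≡ 1ℚ) (sym (inv-unique a b ab≡1)) ab≡1

sumℚ-zipWith-recipRev : ∀ Q m (f : ℕ → ℚ) →
  sumℚ (zipWith _*_ (applyUpTo f (suc m)) (recipRev Q m)) ≡ sumTo (suc m) (λ j → f j * recip Q (m ∸ j))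
sumℚ-zipWith-recipRev Q zero f = refl
sumℚ-zipWith-recipRev Q (suc m) f = cong (f 0 * recip Q (suc m) +_) (sumℚ-zipWith-recipRev Q m (λ j → f (suc j)))

recip-convolution : ∀ Q → Q 0 * inv (Q 0) ≡ 1ℚ → ∀ m →
  sumTo (suc (suc m)) (λ j → Q j * recip Q (suc m ∸ j)) ≡ 0ℚ
-- The j = 0 term is Q 0 * recip Q (m+1), and recip Q (m+1) unfolds to - s′ * inv (Q 0).
recip-convolution Q QQ⁻¹≡1 m = begin
  Q 0 * (- s′ * inv (Q 0)) + s
    ≡⟨ cong (λ t → Q 0 * (- t * inv (Q 0)) + s) (sumℚ-zipWith-recipRev Q m (λ j → Q (suc j))) ⟩
  Q 0 * (- s * inv (Q 0)) + s
    ≡⟨ solve 3 (λ q s i → q :* (:- s :* i) :+ s := :- s :* (q :* i) :+ s) refl (Q 0) s (inv (Q 0)) ⟩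
  - s * (Q 0 * inv (Q 0)) + s    ≡⟨ cong (λ t → - s * t + s) QQ⁻¹≡1 ⟩
  - s * 1ℚ + s                   ≡⟨ solve 1 (λ s → :- s :* con 1ℚ :+ s := con 0ℚ) refl s ⟩
  0ℚ                             ∎
  where
    open ≡-Reasoning
    s′ = sumℚ (zipWith _*_ (applyUpTo (λ j → Q (suc j)) (suc m)) (recipRev Q m))
    s = sumTo (suc m) (λ j → Q (suc j) * recip Q (m ∸ j))

-- Coefficient sequences of z^d · b(z) and of z^d · c(1/z) (for c of degree ≤ d).
delay : ℕ → (ℕ → ℚ) → ℕ → ℚ
delay d b N = if d ≤ᵇ N then b (N ∸ d) else 0ℚ

reversal : ℕ → (ℕ → ℚ) → ℕ → ℚ
reversal d c j = if j ≤ᵇ d then c (d ∸ j) else 0ℚ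

reversal-out : ∀ d c j → d < j → reversal d c j ≡ 0ℚ
reversal-out d c j d<j rewrite ≤ᵇ-false d<j = refl

reversal-in : ∀ d c j → j ≤ d → reversal d c j ≡ c (d ∸ j)
reversal-in d c j j≤d rewrite ≤ᵇ-true j≤d = refl

delay-reversal : ∀ d M j (b : ℕ → ℚ) → j ≤ d → delay d b ((d ∸ j) ℕ.+ M) ≡ reversal M b j
delay-reversal d M j b j≤d with j ℕ.≤? M
... | yes j≤M
  rewrite reversal-in M b j j≤M
        | sym (ℕₚ.+-∸-comm M j≤d) | ℕₚ.+-∸-assoc d j≤M
        | ≤ᵇ-true (ℕₚ.m≤m+n d (M ∸ j)) | ℕₚ.m+n∸m≡n d (M ∸ j) = refl
... | no j≰M
  rewrite reversal-out M b j (ℕₚ.≰⇒> j≰M)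
        | ≤ᵇ-false (ℕₚ.<-≤-trans (ℕₚ.+-monoʳ-< (d ∸ j) (ℕₚ.≰⇒> j≰M)) (ℕₚ.≤-reflexive (ℕₚ.m∸n+n≡m j≤d))) = refl

shiftPoly-delay : ∀ d M (c b : ℕ → ℚ) →
  shiftPoly d c (delay d b) M ≡ sumTo (suc M) (λ j → reversal d c j * b (M ∸ j))
shiftPoly-delay d M c b = begin
  sumTo (suc d) (λ i → c i * delay d b (i ℕ.+ M))
    ≡⟨ sumTo-reverse d (λ i → c i * delay d b (i ℕ.+ M)) ⟩
  sumTo (suc d) (λ j → c (d ∸ j) * delay d b ((d ∸ j) ℕ.+ M))
    ≡⟨ sumTo-cong (suc d) (λ j j<d+1 → cong₂ _*_ (sym (reversal-in d c j (ℕₚ.≤-pred j<d+1)))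
                                                  (delay-reversal d M j b (ℕₚ.≤-pred j<d+1))) ⟩
  sumTo (suc d) (λ j → reversal d c j * reversal M b j)
    ≡⟨ sumTo-support (suc d) (suc M) _
         (λ j d<j → ≡-trans (cong (_* reversal M b j) (reversal-out d c j d<j)) (ℚₚ.*-zeroˡ (reversal M b j)))
         (λ j M<j → ≡-trans (cong (reversal d c j *_) (reversal-out M b j M<j)) (ℚₚ.*-zeroʳ (reversal d c j))) ⟩
  sumTo (suc M) (λ j → reversal d c j * reversal M b j)
    ≡⟨ sumTo-cong (suc M) (λ j j<M+1 → cong (reversal d c j *_) (reversal-in M b j (ℕₚ.≤-pred j<M+1))) ⟩
  sumTo (suc M) (λ j → reversal d c j * b (M ∸ j)) ∎
  where open ≡-Reasoning

inv-cheb-leading : ∀ h → inv (cheb (suc h) (suc h)) ≡ ½^ h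
inv-cheb-leading h = inv-unique (cheb (suc h) (suc h)) (½^ h) (cheb-leading h)

-- coeffInvChebRec h is, by definition, delay (h+1) (recip (reversal (h+1) T_{h+1})).
coeffInvCheb-annihilated : ∀ h → Annihilates (suc h) (cheb (suc h)) (λ N → coeffInvChebRec h (suc N))
coeffInvCheb-annihilated h m = begin
  sumTo (suc d) (λ i → cheb d i * coeffInvChebRec h (suc (i ℕ.+ m)))
    ≡⟨ sumTo-cong (suc d) (λ i _ → cong (λ N → cheb d i * coeffInvChebRec h N) (sym (ℕₚ.+-suc i m))) ⟩
  shiftPoly d (cheb d) (delay d (recip Q)) (suc m)
    ≡⟨ shiftPoly-delay d (suc m) (cheb d) (recip Q) ⟩
  sumTo (suc (suc m)) (λ j → Q j * recip Q (suc m ∸ j))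
    ≡⟨ recip-convolution Q (*-inv (cheb d d) (½^ h) (cheb-leading h)) m ⟩
  0ℚ ∎
  where
    open ≡-Reasoning
    d = suc h
    Q = reversal d (cheb d)

-- For h = 0 the identity fails at n = 0 (p₀ = 1 but 2 [z] z = 2), so the uniqueness
-- argument has no valid initial term; instead both sides vanish for n ≥ 1.
reach≡coeffInvCheb : ∀ h n → 1 ≤ n → Walk.reach h n 0 ≡ twoℚ * coeffInvChebRec h (suc n)
reach≡coeffInvCheb zero (suc m) _ = begin
  Walk.reach 0 m 1                           ≡⟨ Walk.reach-out 0 m 1 (s≤s z≤n) ⟩
  twoℚ * 0ℚ                                  ≡⟨ cong (twoℚ *_) (sym coeff≡0) ⟩
  twoℚ * coeffInvChebRec 0 (suc (suc m))     ∎
  where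
    open ≡-Reasoning
    coeff≡0 : coeffInvChebRec 0 (suc (suc m)) ≡ 0ℚ
    coeff≡0 = Annihilates-X⇒vanish (λ N → coeffInvChebRec 0 (suc N)) (coeffInvCheb-annihilated 0) m
reach≡coeffInvCheb (suc k) n _ =
  Annihilates-unique (suc k) (cheb (suc h)) x y (½^ h) (cheb-leading h) reach-annihilated y-annihilated initial n
  where
    h = suc k
    open Walk h
    x y : ℕ → ℚ
    x m = reach m 0
    y m = twoℚ * coeffInvChebRec h (suc m)
    y-annihilated : Annihilates (suc h) (cheb (suc h)) y
    y-annihilated =
      Annihilates-scale (suc h) (cheb (suc h)) (λ N → coeffInvChebRec h (suc N)) twoℚ (coeffInvCheb-annihilated h)
    initial : ∀ i → i ≤ h → x i ≡ y i
    initial i i≤h with ℕₚ.m≤n⇒m<n∨m≡n i≤h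
    ... | inj₁ i<h rewrite ≤ᵇ-false {suc h} (s≤s i<h) = reach-below i 0 i<h
    ... | inj₂ refl rewrite ≤ᵇ-true (ℕₚ.≤-refl {suc h}) | ℕₚ.n∸n≡0 h | inv-cheb-leading h =
      ≡-trans (reach-exact k 0 refl) (solve 1 (λ a → a := con twoℚ :* (con ½ :* a)) refl (½^ k))

proposition2p2 : (h n : ℕ) → 1 ≤ n →
    prob h n ≡ twoℚ * coeffInvChebRec h (suc n)
proposition2p2 h n 1≤n = ≡-trans (Walk.pathSum≡reach h n 0 z≤n) (reach≡coeffInvCheb h n 1≤n)
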